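{- Let $r\ge 2$ and $m\ge 2$ be integers. Every $m$-tree $F$ (an $r$-graph) has at least two flexible edges.
   Context: An $r$-graph has edges that are $r$-element subsets of its vertex set; its vertex set is taken to be the union of its edges. For an $r$-graph $T$, $P_1(T)$ denotes its $2$-shadow: the set of pairs of vertices contained in some edge of $T$. A $1$-tree is an $r$-graph with exactly one edge. For $i\ge 2$, an $i$-tree is any $r$-graph obtained from an $(i-1)$-tree $T$ by adding a new edge consisting of a pair $ab\in P_1(T)$ together with $r-2$ new vertices not in $T$. An edge $e$ of an $r$-graph $F$ is flexible if there are $r-2$ vertices $v_1,\dots,v_{r-2}\in e$ none of which belongs to any other edge of $F$. -}

module Defs where

open import Data.Nat using (ℕ; suc; _∸_)
open import Data.List using (List; []; _∷_; _++_; length; lookup)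
open import Data.List.Membership.Propositional using (_∈_; _∉_)
open import Data.List.Relation.Unary.All using (All)
open import Data.List.Relation.Unary.Unique.Propositional using (Unique)
open import Data.Fin using (Fin)
open import Data.Product using (Σ; _×_; ∃-syntax)
open import Relation.Nullary using (¬_)
open import Relation.Binary.PropositionalEquality using (_≡_; _≢_)

-- Vertices are natural numbers; an edge is a duplicate-free list of vertices
-- (read as the set of its elements); an r-graph is a list of edges
-- (edges indexed by position).
Edge : Set
Edge = List ℕ

Graph : Set
Graph = List Edge

IsVertex : ℕ → Graph → Set
IsVertex v T = ∃[ f ] (f ∈ T × v ∈ f)

InShadow : ℕ → ℕ → Graph → Set
InShadow a b T = a ≢ b × ∃[ f ] (f ∈ T × a ∈ f × b ∈ f)

data IsTree (r : ℕ) : ℕ → Graph → Set where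
  one  : (e : Edge) → Unique e → length e ≡ r → IsTree r 1 (e ∷ [])
  step : ∀ {i T} → IsTree r i T →
         (a b : ℕ) → InShadow a b T →
         (vs : List ℕ) → Unique vs → length vs ≡ r ∸ 2 →
         All (λ v → ¬ IsVertex v T) vs →
         IsTree r (suc i) (T ++ ((a ∷ b ∷ vs) ∷ []))

Flexible : ℕ → (F : Graph) → Fin (length F) → Set
Flexible r F k =
  ∃[ vs ] (Unique vs × length vs ≡ r ∸ 2 × All (_∈ lookup F k) vs ×
           ((j : Fin (length F)) → j ≢ k → All (_∉ lookup F j) vs))

{-# OPTIONS --safe #-}
-- Induction on the tree, strengthened to: for every shadow pair ab of an i-tree T
-- (i ≥ 1) some edge of T is flexible via r-2 private vertices avoiding a and b.
-- Such an edge stays flexible when the edge {a, b} ∪ vs is glued on, and the new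
-- edge is flexible via its fresh vertices vs; this gives two flexible edges.
-- Conversely, of two flexible edges of T at most one has a private vertex in a
-- shadow pair ab, since that vertex forces the edge carrying ab to be its own.
-- For the 1-tree {e}, the private vertices are e minus a and b.
module Submission where

open import Defs
open import Data.Nat using (ℕ; _≥_; suc; zero; _∸_; s≤s; z≤n)
import Data.Nat.Properties as ℕ
open import Data.List using (List; []; _∷_; _++_; length; lookup)
open import Data.Fin using (Fin; zero; suc)
import Data.Fin.Properties as Fin
open import Data.Product using (Σ; _×_; ∃-syntax; _,_; proj₁)
open import Data.Sum using (_⊎_; inj₁; inj₂)
open import Data.Empty using (⊥-elim)
open import Function using (_∘_)
open import Relation.Nullary using (¬_; Dec; yes; no)
open import Relation.Binary.PropositionalEquality
  using (_≡_; _≢_; refl; sym; trans; cong; subst; setoid)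
open import Data.List.Membership.Propositional using (_∈_; _∉_)
open import Data.List.Membership.Propositional.Properties using (∈-lookup; ∈-∃++)
open import Data.List.Membership.DecPropositional ℕ._≟_ using (_∈?_)
open import Data.List.Relation.Unary.All as All using (All; _∷_)
open import Data.List.Relation.Unary.All.Properties using (All¬⇒¬Any)
open import Data.List.Relation.Unary.Any using (here; there; index; tail)
open import Data.List.Relation.Unary.Any.Properties using (lookup-index)
open import Data.List.Relation.Unary.Unique.Propositional using (Unique)
open import Data.List.Relation.Unary.AllPairs using (_∷_)
open import Data.List.Relation.Binary.Permutation.Setoid (setoid ℕ)
  using (_↭_; ↭-sym; ↭-trans; ↭-prep)
open import Data.List.Relation.Binary.Permutation.Setoid.Properties (setoid ℕ)
  using (∈-resp-↭; Unique-resp-↭; xs↭ys⇒|xs|≡|ys|; ↭-shift)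

∈⇒↭-∷ : ∀ {x xs} → x ∈ xs → ∃[ ys ] xs ↭ x ∷ ys
∈⇒↭-∷ x∈xs with ys , zs , refl ← ∈-∃++ x∈xs = ys ++ zs , ↭-shift ys zs

∈×∈⇒↭-∷-∷ : ∀ {x y xs} → x ≢ y → x ∈ xs → y ∈ xs → ∃[ zs ] xs ↭ x ∷ y ∷ zs
∈×∈⇒↭-∷-∷ x≢y x∈xs y∈xs with ys , xs↭x∷ys ← ∈⇒↭-∷ x∈xs
  with zs , ys↭y∷zs ← ∈⇒↭-∷ (tail (x≢y ∘ sym) (∈-resp-↭ xs↭x∷ys y∈xs))
  = zs , ↭-trans xs↭x∷ys (↭-prep _ ys↭y∷zs)

injectIndex : (T : Graph) (x : Edge) → Fin (length T) → Fin (length (T ++ x ∷ []))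
injectIndex (e ∷ T) x zero = zero
injectIndex (e ∷ T) x (suc k) = suc (injectIndex T x k)

lastIndex : (T : Graph) (x : Edge) → Fin (length (T ++ x ∷ []))
lastIndex [] x = zero
lastIndex (e ∷ T) x = suc (lastIndex T x)

lookup-injectIndex : (T : Graph) (x : Edge) (k : Fin (length T)) →
                     lookup (T ++ x ∷ []) (injectIndex T x k) ≡ lookup T k
lookup-injectIndex (e ∷ T) x zero = refl
lookup-injectIndex (e ∷ T) x (suc k) = lookup-injectIndex T x k

lookup-lastIndex : (T : Graph) (x : Edge) → lookup (T ++ x ∷ []) (lastIndex T x) ≡ x
lookup-lastIndex [] x = refl
lookup-lastIndex (e ∷ T) x = lookup-lastIndex T x

injectIndex≢lastIndex : (T : Graph) (x : Edge) (k : Fin (length T)) →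
                        injectIndex T x k ≢ lastIndex T x
injectIndex≢lastIndex (e ∷ T) x zero ()
injectIndex≢lastIndex (e ∷ T) x (suc k) eq = injectIndex≢lastIndex T x k (Fin.suc-injective eq)

data AppendView (T : Graph) (x : Edge) : Fin (length (T ++ x ∷ [])) → Set where
  old : (k : Fin (length T)) → AppendView T x (injectIndex T x k)
  new : AppendView T x (lastIndex T x)

appendView : (T : Graph) (x : Edge) (j : Fin (length (T ++ x ∷ []))) → AppendView T x j
appendView [] x zero = new
appendView (e ∷ T) x zero = old zero
appendView (e ∷ T) x (suc j) with appendView T x j
... | old k = old (suc k)
... | new = new

flexible-injectIndex : ∀ {r} T x k (fl : Flexible r T k) → All (_∉ x) (proj₁ fl) →
                       Flexible r (T ++ x ∷ []) (injectIndex T x k)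
flexible-injectIndex T x k (ws , ws-unique , ws-length , ws⊆k , ws-private) ws∩x=∅ =
  ws , ws-unique , ws-length , ws⊆k′ , ws-private′
  where
  ws⊆k′ : All (_∈ lookup (T ++ x ∷ []) (injectIndex T x k)) ws
  ws⊆k′ rewrite lookup-injectIndex T x k = ws⊆k
  ws-private′ : ∀ j → j ≢ injectIndex T x k → All (_∉ lookup (T ++ x ∷ []) j) ws
  ws-private′ j j≢k with appendView T x j
  ... | old k′ rewrite lookup-injectIndex T x k′ = ws-private k′ (j≢k ∘ cong (injectIndex T x))
  ... | new rewrite lookup-lastIndex T x = ws∩x=∅

flexible-lastIndex : ∀ {r} T x vs → Unique vs → length vs ≡ r ∸ 2 → All (_∈ x) vs →
                     All (λ v → ¬ IsVertex v T) vs → Flexible r (T ++ x ∷ []) (lastIndex T x)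
flexible-lastIndex T x vs vs-unique vs-length vs⊆x vs-fresh =
  vs , vs-unique , vs-length , vs⊆x′ , vs-private
  where
  vs⊆x′ : All (_∈ lookup (T ++ x ∷ []) (lastIndex T x)) vs
  vs⊆x′ rewrite lookup-lastIndex T x = vs⊆x
  vs-private : ∀ j → j ≢ lastIndex T x → All (_∉ lookup (T ++ x ∷ []) j) vs
  vs-private j j≢last with appendView T x j
  ... | old k rewrite lookup-injectIndex T x k =
    All.map (λ v-fresh v∈k → v-fresh (lookup T k , ∈-lookup k , v∈k)) vs-fresh
  ... | new = ⊥-elim (j≢last refl)

private-vertex-edge : ∀ {r T k w f} (fl : Flexible r T k) → w ∈ proj₁ fl →
                      f ∈ T → w ∈ f → f ≡ lookup T k
private-vertex-edge {k = k} (_ , _ , _ , _ , ws-private) w∈ws f∈T w∈f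
  with index f∈T Fin.≟ k
... | yes refl = lookup-index f∈T
... | no f≢k = ⊥-elim (All.lookup (ws-private (index f∈T) f≢k) w∈ws
                         (subst (_ ∈_) (lookup-index f∈T) w∈f))

Avoids : List ℕ → ℕ → ℕ → Set
Avoids ws a b = a ∉ ws × b ∉ ws

FlexibleAvoiding : ℕ → Graph → ℕ → ℕ → Set
FlexibleAvoiding r T a b = ∃[ k ] Σ (Flexible r T k) λ fl → Avoids (proj₁ fl) a b

avoids-other-edge : ∀ {r T i j a b} → i ≢ j → (fj : Flexible r T j) →
                    a ∈ lookup T i → b ∈ lookup T i → Avoids (proj₁ fj) a b
avoids-other-edge i≢j (_ , _ , _ , _ , ws-private) a∈i b∈i =
  (λ a∈ws → All.lookup i-private a∈ws a∈i) , (λ b∈ws → All.lookup i-private b∈ws b∈i)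
  where i-private = ws-private _ i≢j

shadow-pair-avoids-one : ∀ {r T i j a b} → i ≢ j →
                         (fi : Flexible r T i) (fj : Flexible r T j) → InShadow a b T →
                         Avoids (proj₁ fi) a b ⊎ Avoids (proj₁ fj) a b
shadow-pair-avoids-one {r} {T} {i} {a = a} {b} i≢j fi fj (_ , f , f∈T , a∈f , b∈f) =
  by-cases (a ∈? proj₁ fi) (b ∈? proj₁ fi)
  where
  fj-avoids : ∀ {w} → w ∈ proj₁ fi → w ∈ f → Avoids (proj₁ fj) a b
  fj-avoids w∈ws w∈f =
    avoids-other-edge {r} {T} i≢j fj (subst (a ∈_) f≡i a∈f) (subst (b ∈_) f≡i b∈f)
    where
    f≡i : f ≡ lookup T i
    f≡i = private-vertex-edge {r} {T} fi w∈ws f∈T w∈f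
  by-cases : Dec (a ∈ proj₁ fi) → Dec (b ∈ proj₁ fi) →
             Avoids (proj₁ fi) a b ⊎ Avoids (proj₁ fj) a b
  by-cases (no a∉) (no b∉) = inj₁ (a∉ , b∉)
  by-cases (yes a∈) _ = inj₂ (fj-avoids a∈ a∈f)
  by-cases _ (yes b∈) = inj₂ (fj-avoids b∈ b∈f)

avoids-new-edge : ∀ {r T k a b vs} (fl : Flexible r T k) → Avoids (proj₁ fl) a b →
                  All (λ v → ¬ IsVertex v T) vs → All (_∉ a ∷ b ∷ vs) (proj₁ fl)
avoids-new-edge {T = T} {k} (ws , _ , _ , ws⊆k , _) (a∉ws , b∉ws) vs-fresh =
  All.tabulate λ where
    w∈ws (here refl) → a∉ws w∈ws
    w∈ws (there (here refl)) → b∉ws w∈ws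
    w∈ws (there (there w∈vs)) →
      All.lookup vs-fresh w∈vs (lookup T k , ∈-lookup k , All.lookup ws⊆k w∈ws)

single-edge-flexible-avoiding : ∀ {r e a b} → Unique e → length e ≡ r →
                                InShadow a b (e ∷ []) → FlexibleAvoiding r (e ∷ []) a b
single-edge-flexible-avoiding {r} {e} e-unique e-length (a≢b , _ , here refl , a∈e , b∈e)
  with ws , e↭a∷b∷ws ← ∈×∈⇒↭-∷-∷ a≢b a∈e b∈e
  with (_ ∷ a≢ws) ∷ b≢ws ∷ ws-unique ← Unique-resp-↭ e↭a∷b∷ws e-unique
  = zero , (ws , ws-unique , ws-length , ws⊆e , λ { zero 0≢0 → ⊥-elim (0≢0 refl) })
  , All¬⇒¬Any a≢ws , All¬⇒¬Any b≢ws
  where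
  ws-length : length ws ≡ r ∸ 2
  ws-length = cong (_∸ 2) (trans (sym (xs↭ys⇒|xs|≡|ys| e↭a∷b∷ws)) e-length)
  ws⊆e : All (_∈ e) ws
  ws⊆e = All.tabulate (∈-resp-↭ (↭-sym e↭a∷b∷ws) ∘ there ∘ there)
single-edge-flexible-avoiding _ _ (_ , _ , there () , _)

two-flexible-edges : ∀ {r n F} → IsTree r (suc (suc n)) F →
                     ∃[ i ] ∃[ j ] (i ≢ j × Flexible r F i × Flexible r F j)

flexible-avoiding : ∀ {r n T a b} → IsTree r (suc n) T → InShadow a b T →
                    FlexibleAvoiding r T a b

two-flexible-edges {r} (step {T = T} t a b ab∈T vs vs-unique vs-length vs-fresh)
  with k , fk , avoids ← flexible-avoiding t ab∈T
  = injectIndex T x k , lastIndex T x , injectIndex≢lastIndex T x k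
  , flexible-injectIndex {r} T x k fk (avoids-new-edge {r} {T} {k} fk avoids vs-fresh)
  , flexible-lastIndex {r} T x vs vs-unique vs-length (All.tabulate (there ∘ there)) vs-fresh
  where x = a ∷ b ∷ vs

flexible-avoiding (one e e-unique e-length) ab∈e =
  single-edge-flexible-avoiding e-unique e-length ab∈e
flexible-avoiding {n = zero} (step () _ _ _ _ _ _ _)
flexible-avoiding {r} {suc _} {T} t ab∈T with i , j , i≢j , fi , fj ← two-flexible-edges t
  with shadow-pair-avoids-one {r} {T} i≢j fi fj ab∈T
... | inj₁ avoids = i , fi , avoids
... | inj₂ avoids = j , fj , avoids

lemma4p6 : (r m : ℕ) → r ≥ 2 → m ≥ 2 → (F : Graph) → IsTree r m F →
           ∃[ i ] ∃[ j ] (i ≢ j × Flexible r F i × Flexible r F j)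
lemma4p6 r (suc (suc n)) _ (s≤s (s≤s z≤n)) F t = two-flexible-edges t
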